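{- Let $G$ be a group, $g_1,\dots,g_u\in G$, $r=2u$, and write $[g_1,\dots,g_u]=(g_1,\dots,g_u,g_u^{ -1},\dots,g_1^{ -1})\in G^r$. For any $\pi\in S_u$ there exists $Q\in B_r$ with $([g_1,\dots,g_u])Q=[g_{(1)\pi},\dots,g_{(u)\pi}]$.
   Context: The braid group $B_r$ with generators $Q_1,\dots,Q_{r-1}$ acts on the right on $G^r$ by $(\mathbf g)Q_i=(g_1,\dots,g_{i-1},g_ig_{i+1}g_i^{ -1},g_i,g_{i+2},\dots,g_r)$. Permutations in $S_u$ act on the right of integers. -}

module Defs where

open import Level using (Level)
open import Data.Nat using (ℕ; zero; suc; _+_; _<_)
open import Data.Fin using (Fin; toℕ; fromℕ<; splitAt; opposite)
open import Data.Fin.Permutation using (Permutation′; _⟨$⟩ʳ_)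
open import Data.List using (List; []; _∷_)
open import Data.Product using (Σ; _×_; _,_)
open import Data.Sum using (inj₁; inj₂)
open import Data.Bool using (Bool; true; false)
open import Data.Nat.Properties using (<-trans; n<1+n)
open import Data.Vec.Functional using (Vector)
open import Relation.Nullary using (yes; no)
open import Algebra.Bundles using (Group)
import Data.Nat as N

-- A letter is a generator
-- Q_{i+1} (0-based i with i+1 < m, acting on positions i, i+1) together with
-- a sign (true = Q_{i+1}, false = Q_{i+1}⁻¹).  Elements of B_m are words in
-- these letters; the Hurwitz action is well defined on B_m.
BraidLetter : ℕ → Set
BraidLetter m = Σ ℕ (λ i → suc i < m) × Bool

BraidWord : ℕ → Set
BraidWord m = List (BraidLetter m)

module _ {c ℓ : Level} (G : Group c ℓ) where
  open Group G

  -- right action of Q^{±1} on G^m, tuples as functions Fin m → G (0-based)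
  -- Q  : (.., a, b, ..) ↦ (.., a b a⁻¹, a, ..)
  -- Q⁻¹: (.., a, b, ..) ↦ (.., b, b⁻¹ a b, ..)   (inverse of Q)
  actLetter : ∀ {m} → Vector Carrier m → BraidLetter m → Vector Carrier m
  actLetter {m} g ((i , p) , s) k with toℕ k N.≟ i | toℕ k N.≟ suc i
  ... | no _  | no _  = g k
  ... | yes _ | _     with s
  ...   | true  = a ∙ b ∙ a ⁻¹
    where a = g (fromℕ< (<-trans (n<1+n i) p)); b = g (fromℕ< p)
  ...   | false = g (fromℕ< p)
  actLetter {m} g ((i , p) , s) k | no _ | yes _ with s
  ...   | true  = g (fromℕ< (<-trans (n<1+n i) p))
  ...   | false = b ⁻¹ ∙ a ∙ b
    where a = g (fromℕ< (<-trans (n<1+n i) p)); b = g (fromℕ< p)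

  actWord : ∀ {m} → Vector Carrier m → BraidWord m → Vector Carrier m
  actWord g []       = g
  actWord g (l ∷ ls) = actWord (actLetter g l) ls

  _≋_ : ∀ {m} → Vector Carrier m → Vector Carrier m → Set ℓ
  x ≋ y = ∀ k → x k ≈ y k

  bracket : ∀ u → Vector Carrier u → Vector Carrier (u + u)
  bracket u g k with splitAt u k
  ... | inj₁ j = g j
  ... | inj₂ j = g (opposite j) ⁻¹

  -- permuted tuple (g_{(1)π},…,g_{(u)π}); π acts on the right of indices
  permute : ∀ {u} → Permutation′ u → Vector Carrier u → Vector Carrier u
  permute π g i = g (π ⟨$⟩ʳ i)

-- The word Q₁⁻¹ ⋯ Q_k⁻¹ carries an entry x rightwards across a block b₁ … b_k, leaving the block in
-- place and conjugating x by b₁ ⋯ b_k; dually Q_k ⋯ Q₁ carries an entry leftwards. Since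
-- [g₁,…,g_u] = g₁ [g₂,…,g_u] g₁⁻¹ and every bracket has product 1, entries cross brackets unchanged,
-- which is enough to swap the first two entries of a bracket. A word permuting the entries of the
-- inner bracket [g₂,…,g_u] permutes them inside g₁ [g₂,…,g_u] g₁⁻¹ too, so bringing any entry to the
-- front is realised by nested swaps, and every permutation is a permutation of the last u − 1 entries
-- followed by bringing one entry to the front.
-- Tuples are modelled by sequences ℕ → G, on which braid letters act without range conditions; the
-- action on G^(2u) is the restriction of that action.
module Submission where

open import Level using (Level; _⊔_)
open import Data.Bool using (Bool; true; false)
open import Data.Fin using (Fin; zero; suc; toℕ; fromℕ<; lift; punchIn; splitAt; opposite)
open import Data.Fin.Permutation using (Permutation′; _⟨$⟩ʳ_; remove; punchIn-permute)
open import Data.Fin.Properties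
  using (toℕ<n; toℕ-fromℕ<; toℕ-↑ˡ; toℕ-↑ʳ; splitAt⁻¹-↑ˡ; splitAt⁻¹-↑ʳ; opposite-prop)
open import Data.List using (List; []; _∷_; _++_; _∷ʳ_; [_]; length; map; foldl; foldr)
open import Data.List.Properties using (foldl-++; length-++)
open import Data.Nat using (ℕ; zero; suc; _+_; _<_; _≤_; _≟_; s≤s; z≤n)
open import Data.Nat.Properties
  using (+-comm; +-suc; +-identityʳ; +-monoʳ-≤; +-monoˡ-≤; ≤-refl; n≤1+n; m≤n+m; m∸n+n≡m; suc-injective;
         ≤-trans; ≤-reflexive; <-trans; n<1+n)
open import Data.Product using (∃; _×_; _,_; proj₁; proj₂)
open import Data.Sum using (inj₁; inj₂)
open import Data.Vec.Functional using (Vector; head; tail)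
open import Function using (id; _∘_)
open import Function.Indexed.Relation.Binary.Equality using (≡-setoid)
open import Relation.Binary.Bundles using (Setoid)
import Relation.Binary.Reasoning.Setoid
open import Relation.Binary.Indexed.Heterogeneous.Construct.Trivial using (indexedSetoid)
open import Relation.Binary.PropositionalEquality as ≡ using (_≡_; _≢_)
open import Relation.Nullary using (yes; no; contradiction)
open import Algebra.Bundles using (Group)
open import Defs

module Hurwitz {c ℓ : Level} (G : Group c ℓ) where
  open Group G
  open import Algebra.Properties.Group G using (⁻¹-anti-homo-∙; ε⁻¹≈ε)
  open import Algebra.Solver.Monoid monoid using (solve; _⊜_; _⊕_)

  conjʳ-∙ : ∀ b p x → (b ∙ p) ⁻¹ ∙ x ∙ (b ∙ p) ≈ p ⁻¹ ∙ (b ⁻¹ ∙ x ∙ b) ∙ p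
  conjʳ-∙ b p x = trans (∙-congʳ (∙-congʳ (⁻¹-anti-homo-∙ b p)))
    (solve 5 (λ p′ b′ x b p → ((p′ ⊕ b′) ⊕ x) ⊕ (b ⊕ p) ⊜ (p′ ⊕ ((b′ ⊕ x) ⊕ b)) ⊕ p) refl
       (p ⁻¹) (b ⁻¹) x b p)

  conjˡ-∙ : ∀ b p x → (b ∙ p) ∙ x ∙ (b ∙ p) ⁻¹ ≈ b ∙ (p ∙ x ∙ p ⁻¹) ∙ b ⁻¹
  conjˡ-∙ b p x = trans (∙-congˡ (⁻¹-anti-homo-∙ b p))
    (solve 5 (λ b p x p′ b′ → ((b ⊕ p) ⊕ x) ⊕ (p′ ⊕ b′) ⊜ ((b ⊕ ((p ⊕ x) ⊕ p′)) ⊕ b′)) refl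
       b p x (p ⁻¹) (b ⁻¹))

  conjʳ-ε : ∀ {p} x → p ≈ ε → p ⁻¹ ∙ x ∙ p ≈ x
  conjʳ-ε x p≈ε = trans (∙-cong (∙-congʳ (trans (⁻¹-cong p≈ε) ε⁻¹≈ε)) p≈ε)
                        (trans (identityʳ _) (identityˡ x))

  conjˡ-ε : ∀ {p} x → p ≈ ε → p ∙ x ∙ p ⁻¹ ≈ x
  conjˡ-ε x p≈ε = trans (∙-cong (∙-congʳ p≈ε) (trans (⁻¹-cong p≈ε) ε⁻¹≈ε))
                        (trans (identityʳ _) (identityˡ x))

  product : List Carrier → Carrier
  product = foldr _∙_ ε

  product-++ : ∀ xs ys → product (xs ++ ys) ≈ product xs ∙ product ys
  product-++ []       ys = sym (identityˡ _)
  product-++ (x ∷ xs) ys = trans (∙-congˡ (product-++ xs ys)) (sym (assoc x _ _))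

  seqSetoid : Setoid c ℓ
  seqSetoid = ≡-setoid ℕ (indexedSetoid setoid)

  open Setoid seqSetoid public using () renaming (Carrier to Seq; _≈_ to _≐_; refl to ≐-refl; trans to ≐-trans)
  module ≐-Reasoning = Relation.Binary.Reasoning.Setoid seqSetoid

  infixr 5 _∷ˢ_ _++ˢ_

  _∷ˢ_ : Carrier → Seq → Seq
  (x ∷ˢ f) zero    = x
  (x ∷ˢ f) (suc n) = f n

  _++ˢ_ : List Carrier → Seq → Seq
  []       ++ˢ f = f
  (x ∷ xs) ++ˢ f = x ∷ˢ (xs ++ˢ f)

  ∷ˢ-cong : ∀ {x y f h} → x ≈ y → f ≐ h → x ∷ˢ f ≐ y ∷ˢ h
  ∷ˢ-cong x≈y f≐h zero    = x≈y
  ∷ˢ-cong x≈y f≐h (suc n) = f≐h n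

  ++ˢ-congʳ : ∀ xs {f h} → f ≐ h → xs ++ˢ f ≐ xs ++ˢ h
  ++ˢ-congʳ []       f≐h = f≐h
  ++ˢ-congʳ (x ∷ xs) f≐h = ∷ˢ-cong refl (++ˢ-congʳ xs f≐h)

  ++ˢ-++ : ∀ xs ys f → (xs ++ ys) ++ˢ f ≐ xs ++ˢ (ys ++ˢ f)
  ++ˢ-++ []       ys f = ≐-refl
  ++ˢ-++ (x ∷ xs) ys f = ∷ˢ-cong refl (++ˢ-++ xs ys f)

  ++ˢ-length : ∀ xs f n → (xs ++ˢ f) (length xs + n) ≡ f n
  ++ˢ-length []       f n = ≡.refl
  ++ˢ-length (x ∷ xs) f n = ++ˢ-length xs f n

  move : Bool → Carrier → Carrier → Carrier × Carrier
  move true  a b = a ∙ b ∙ a ⁻¹ , a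
  move false a b = b , b ⁻¹ ∙ a ∙ b

  move-cong : ∀ s {a a′ b b′} → a ≈ a′ → b ≈ b′ →
              proj₁ (move s a b) ≈ proj₁ (move s a′ b′) × proj₂ (move s a b) ≈ proj₂ (move s a′ b′)
  move-cong true  a≈ b≈ = ∙-cong (∙-cong a≈ b≈) (⁻¹-cong a≈) , a≈
  move-cong false a≈ b≈ = b≈ , ∙-cong (∙-cong (⁻¹-cong b≈) a≈) b≈

  moveAt : ℕ → Bool → Seq → Seq
  moveAt zero    s f = proj₁ (move s (f 0) (f 1)) ∷ˢ proj₂ (move s (f 0) (f 1)) ∷ˢ λ n → f (2 + n)
  moveAt (suc i) s f = f 0 ∷ˢ moveAt i s (λ n → f (suc n))

  moveAt-cong : ∀ i s {f h} → f ≐ h → moveAt i s f ≐ moveAt i s h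
  moveAt-cong zero    s f≐h zero          = proj₁ (move-cong s (f≐h 0) (f≐h 1))
  moveAt-cong zero    s f≐h (suc zero)    = proj₂ (move-cong s (f≐h 0) (f≐h 1))
  moveAt-cong zero    s f≐h (suc (suc n)) = f≐h (2 + n)
  moveAt-cong (suc i) s f≐h zero          = f≐h 0
  moveAt-cong (suc i) s f≐h (suc n)       = moveAt-cong i s (f≐h ∘ suc) n

  moveAt-fst : ∀ i s f → moveAt i s f i ≡ proj₁ (move s (f i) (f (suc i)))
  moveAt-fst zero    s f = ≡.refl
  moveAt-fst (suc i) s f = moveAt-fst i s (f ∘ suc)

  moveAt-snd : ∀ i s f → moveAt i s f (suc i) ≡ proj₂ (move s (f i) (f (suc i)))
  moveAt-snd zero    s f = ≡.refl
  moveAt-snd (suc i) s f = moveAt-snd i s (f ∘ suc)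

  moveAt-other : ∀ i s f {n} → n ≢ i → n ≢ suc i → moveAt i s f n ≡ f n
  moveAt-other zero    s f {zero}        n≢i _     = contradiction ≡.refl n≢i
  moveAt-other zero    s f {suc zero}    _   n≢1+i = contradiction ≡.refl n≢1+i
  moveAt-other zero    s f {suc (suc n)} _   _     = ≡.refl
  moveAt-other (suc i) s f {zero}        _   _     = ≡.refl
  moveAt-other (suc i) s f {suc n}       n≢i n≢1+i =
    moveAt-other i s (f ∘ suc) (n≢i ∘ ≡.cong suc) (n≢1+i ∘ ≡.cong suc)

  actLetterˢ : ∀ {m} → Seq → BraidLetter m → Seq
  actLetterˢ f ((i , _) , s) = moveAt i s f

  actWordˢ : ∀ {m} → Seq → BraidWord m → Seq
  actWordˢ = foldl actLetterˢ

  actWordˢ-cong : ∀ {m} (W : BraidWord m) {f h} → f ≐ h → actWordˢ f W ≐ actWordˢ h W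
  actWordˢ-cong []                  f≐h = f≐h
  actWordˢ-cong (((i , _) , s) ∷ W) f≐h = actWordˢ-cong W (moveAt-cong i s f≐h)

  actWordˢ-++-trans : ∀ {m} f (W W′ : BraidWord m) {f′ f″} →
                actWordˢ f W ≐ f′ → actWordˢ f′ W′ ≐ f″ → actWordˢ f (W ++ W′) ≐ f″
  actWordˢ-++-trans f W W′ {f′} {f″} fW≐f′ f′W′≐f″ = begin
    actWordˢ f (W ++ W′)         ≡⟨ foldl-++ actLetterˢ f W W′ ⟩
    actWordˢ (actWordˢ f W) W′   ≈⟨ actWordˢ-cong W′ fW≐f′ ⟩
    actWordˢ f′ W′               ≈⟨ f′W′≐f″ ⟩
    f″                           ∎
    where open ≐-Reasoning

  shift : ∀ {m} → BraidWord m → BraidWord (suc m)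
  shift = map λ { ((i , i<m) , s) → (suc i , s≤s i<m) , s }

  actWordˢ-shift : ∀ {m} x f (W : BraidWord m) → actWordˢ (x ∷ˢ f) (shift W) ≡ x ∷ˢ actWordˢ f W
  actWordˢ-shift x f []                  = ≡.refl
  actWordˢ-shift x f (((i , _) , s) ∷ W) = actWordˢ-shift x (moveAt i s f) W

  shiftBy : ∀ {m} n → BraidWord m → BraidWord (n + m)
  shiftBy zero    W = W
  shiftBy (suc n) W = shift (shiftBy n W)

  actWordˢ-shiftBy : ∀ {m} xs f (W : BraidWord m) →
                     actWordˢ (xs ++ˢ f) (shiftBy (length xs) W) ≡ xs ++ˢ actWordˢ f W
  actWordˢ-shiftBy []       f W = ≡.refl
  actWordˢ-shiftBy (x ∷ xs) f W =
    ≡.trans (actWordˢ-shift x (xs ++ˢ f) (shiftBy (length xs) W)) (≡.cong (x ∷ˢ_) (actWordˢ-shiftBy xs f W))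

  weaken : ∀ {m n} → m ≤ n → BraidWord m → BraidWord n
  weaken m≤n = map λ { ((i , i<m) , s) → (i , ≤-trans i<m m≤n) , s }

  actWordˢ-weaken : ∀ {m n} (m≤n : m ≤ n) f (W : BraidWord m) → actWordˢ f (weaken m≤n W) ≡ actWordˢ f W
  actWordˢ-weaken m≤n f []                  = ≡.refl
  actWordˢ-weaken m≤n f (((i , _) , s) ∷ W) = actWordˢ-weaken m≤n (moveAt i s f) W

  passRight : ∀ k → BraidWord (suc k)
  passRight zero    = []
  passRight (suc k) = ((0 , s≤s (s≤s z≤n)) , false) ∷ shift (passRight k)

  passLeft : ∀ k → BraidWord (suc k)
  passLeft zero    = []
  passLeft (suc k) = shift (passLeft k) ∷ʳ ((0 , s≤s (s≤s z≤n)) , true)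

  actWordˢ-passRight : ∀ xs x f →
    actWordˢ (x ∷ˢ (xs ++ˢ f)) (passRight (length xs)) ≐ xs ++ˢ ((product xs ⁻¹ ∙ x ∙ product xs) ∷ˢ f)
  actWordˢ-passRight []       x f = ∷ˢ-cong (sym (conjʳ-ε x refl)) ≐-refl
  actWordˢ-passRight (y ∷ xs) x f = begin
    actWordˢ (y ∷ˢ x′ ∷ˢ (xs ++ˢ f)) (shift (passRight (length xs)))
      ≡⟨ actWordˢ-shift y _ (passRight (length xs)) ⟩
    y ∷ˢ actWordˢ (x′ ∷ˢ (xs ++ˢ f)) (passRight (length xs))
      ≈⟨ ∷ˢ-cong refl (actWordˢ-passRight xs x′ f) ⟩
    y ∷ˢ (xs ++ˢ ((p ⁻¹ ∙ x′ ∙ p) ∷ˢ f))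
      ≈⟨ ++ˢ-congʳ (y ∷ xs) (∷ˢ-cong (sym (conjʳ-∙ y p x)) ≐-refl) ⟩
    y ∷ˢ (xs ++ˢ (((y ∙ p) ⁻¹ ∙ x ∙ (y ∙ p)) ∷ˢ f)) ∎
    where open ≐-Reasoning; x′ = y ⁻¹ ∙ x ∙ y; p = product xs

  actWordˢ-passLeft : ∀ xs x f →
    actWordˢ (xs ++ˢ (x ∷ˢ f)) (passLeft (length xs)) ≐ (product xs ∙ x ∙ product xs ⁻¹) ∷ˢ (xs ++ˢ f)
  actWordˢ-passLeft []       x f = ∷ˢ-cong (sym (conjˡ-ε x refl)) ≐-refl
  actWordˢ-passLeft (y ∷ xs) x f = begin
    actWordˢ (y ∷ˢ (xs ++ˢ (x ∷ˢ f))) (W ∷ʳ Q₁)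
      ≡⟨ foldl-++ actLetterˢ _ W [ Q₁ ] ⟩
    moveAt 0 true (actWordˢ (y ∷ˢ (xs ++ˢ (x ∷ˢ f))) W)
      ≡⟨ ≡.cong (moveAt 0 true) (actWordˢ-shift y _ (passLeft (length xs))) ⟩
    moveAt 0 true (y ∷ˢ actWordˢ (xs ++ˢ (x ∷ˢ f)) (passLeft (length xs)))
      ≈⟨ moveAt-cong 0 true (∷ˢ-cong refl (actWordˢ-passLeft xs x f)) ⟩
    (y ∙ (p ∙ x ∙ p ⁻¹) ∙ y ⁻¹) ∷ˢ y ∷ˢ (xs ++ˢ f)
      ≈⟨ ∷ˢ-cong (sym (conjˡ-∙ y p x)) ≐-refl ⟩
    ((y ∙ p) ∙ x ∙ (y ∙ p) ⁻¹) ∷ˢ y ∷ˢ (xs ++ˢ f) ∎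
    where open ≐-Reasoning; W = shift (passLeft (length xs)); Q₁ = (0 , s≤s (s≤s z≤n)) , true; p = product xs

  passRight-trivial : ∀ xs x f → product xs ≈ ε →
                      actWordˢ (x ∷ˢ (xs ++ˢ f)) (passRight (length xs)) ≐ xs ++ˢ (x ∷ˢ f)
  passRight-trivial xs x f p≈ε =
    ≐-trans (actWordˢ-passRight xs x f) (++ˢ-congʳ xs (∷ˢ-cong (conjʳ-ε x p≈ε) ≐-refl))

  passLeft-trivial : ∀ xs x f → product xs ≈ ε →
                     actWordˢ (xs ++ˢ (x ∷ˢ f)) (passLeft (length xs)) ≐ x ∷ˢ (xs ++ˢ f)
  passLeft-trivial xs x f p≈ε =
    ≐-trans (actWordˢ-passLeft xs x f) (∷ˢ-cong (conjˡ-ε x p≈ε) ≐-refl)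

  bracketList : ∀ u → Vector Carrier u → List Carrier
  bracketList zero    g = []
  bracketList (suc u) g = head g ∷ (bracketList u (tail g) ∷ʳ head g ⁻¹)

  bracketList-cong : ∀ u {g h : Vector Carrier u} → (∀ i → g i ≡ h i) → bracketList u g ≡ bracketList u h
  bracketList-cong zero    g≗h = ≡.refl
  bracketList-cong (suc u) g≗h =
    ≡.cong₂ (λ a xs → a ∷ (xs ∷ʳ a ⁻¹)) (g≗h zero) (bracketList-cong u (g≗h ∘ suc))

  length-bracketList : ∀ u g → length (bracketList u g) ≡ u + u
  length-bracketList zero    g = ≡.refl
  length-bracketList (suc u) g = ≡.cong suc (begin
    length (bracketList u (tail g) ++ [ head g ⁻¹ ]) ≡⟨ length-++ (bracketList u (tail g)) ⟩
    length (bracketList u (tail g)) + 1             ≡⟨ +-comm _ 1 ⟩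
    suc (length (bracketList u (tail g)))           ≡⟨ ≡.cong suc (length-bracketList u (tail g)) ⟩
    suc (u + u)                                     ≡⟨ +-suc u u ⟨
    u + suc u                                       ∎)
    where open ≡.≡-Reasoning

  product-bracketList : ∀ u g → product (bracketList u g) ≈ ε
  product-bracketList zero    g = refl
  product-bracketList (suc u) g = trans (∙-congˡ (product-++ (bracketList u (tail g)) [ a ⁻¹ ]))
    (trans (∙-congˡ (trans (∙-cong (product-bracketList u (tail g)) (identityʳ (a ⁻¹))) (identityˡ (a ⁻¹))))
           (inverseʳ a))
    where a = head g

  bracketList-++ˢ : ∀ u g f →
                    bracketList (suc u) g ++ˢ f ≐ head g ∷ˢ (bracketList u (tail g) ++ˢ (head g ⁻¹ ∷ˢ f))
  bracketList-++ˢ u g f = ++ˢ-++ (head g ∷ bracketList u (tail g)) [ head g ⁻¹ ] f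

  -- The arbitrary tail r lets a realising word be reused, shifted, inside an enclosing pair a … a⁻¹.
  record Realisable (u : ℕ) (f : Fin u → Fin u) : Set (c ⊔ ℓ) where
    field realise : ∀ (g : Vector Carrier u) → ∃ λ (W : BraidWord (u + u)) →
                    ∀ r → actWordˢ (bracketList u g ++ˢ r) W ≐ bracketList u (g ∘ f) ++ˢ r
  open Realisable public

  realisable-id : ∀ {u} → Realisable u id
  realise realisable-id g = [] , λ r → ≐-refl

  realisable-∘ : ∀ {u f h} → Realisable u f → Realisable u h → Realisable u (f ∘ h)
  realise (realisable-∘ {f = f} real-f real-h) g =
    let W , W-realises = realise real-f g
        W′ , W′-realises = realise real-h (g ∘ f)
    in W ++ W′ , λ r → actWordˢ-++-trans (bracketList _ g ++ˢ r) W W′ (W-realises r) (W′-realises r)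

  realisable-ext : ∀ {u f h} → (∀ i → f i ≡ h i) → Realisable u f → Realisable u h
  realise (realisable-ext {u} f≗h real-f) g =
    let W , W-realises = realise real-f g
    in W , λ r → ≐-trans (W-realises r)
                   (Setoid.reflexive seqSetoid (≡.cong (_++ˢ r) (bracketList-cong u (≡.cong g ∘ f≗h))))

  realisable-lift : ∀ {u f} → Realisable u f → Realisable (suc u) (lift 1 f)
  realise (realisable-lift {u} {f} real-f) g =
    let W , W-realises = realise real-f (tail g)
    in weaken (s≤s (+-monoʳ-≤ u (n≤1+n u))) (shift W) , λ r → begin
      actWordˢ (bracketList (suc u) g ++ˢ r) (weaken _ (shift W))
        ≡⟨ actWordˢ-weaken _ _ (shift W) ⟩
      actWordˢ (bracketList (suc u) g ++ˢ r) (shift W)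
        ≈⟨ actWordˢ-cong (shift W) (bracketList-++ˢ u g r) ⟩
      actWordˢ (a ∷ˢ (bracketList u (tail g) ++ˢ (a ⁻¹ ∷ˢ r))) (shift W)
        ≡⟨ actWordˢ-shift a _ W ⟩
      a ∷ˢ actWordˢ (bracketList u (tail g) ++ˢ (a ⁻¹ ∷ˢ r)) W
        ≈⟨ ∷ˢ-cong refl (W-realises (a ⁻¹ ∷ˢ r)) ⟩
      a ∷ˢ (bracketList u (tail g ∘ f) ++ˢ (a ⁻¹ ∷ˢ r))
        ≈⟨ bracketList-++ˢ u (g ∘ lift 1 f) r ⟨
      bracketList (suc u) (g ∘ lift 1 f) ++ˢ r ∎
    where open ≐-Reasoning; a = head g

  swap₀₁ : ∀ {u} → Fin (suc (suc u)) → Fin (suc (suc u))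
  swap₀₁ zero          = suc zero
  swap₀₁ (suc zero)    = zero
  swap₀₁ (suc (suc i)) = suc (suc i)

  -- a b [h] b⁻¹ a⁻¹  ↦  b [h] b⁻¹ a a⁻¹  ↦  b [h] a a⁻¹ b⁻¹  ↦  b a [h] a⁻¹ b⁻¹, each step moving one
  -- entry across a block of product 1.
  realisable-swap₀₁ : ∀ {u} → Realisable (suc (suc u)) swap₀₁
  realise (realisable-swap₀₁ {u}) g =
    W₁ ++ W₂ ++ W₃ , λ r →
      actWordˢ-++-trans (S₀ r) W₁ (W₂ ++ W₃) (step₁ r) (actWordˢ-++-trans (S₁ r) W₂ W₃ (step₂ r) (step₃ r))
    where
    open ≐-Reasoning
    a = g zero
    b = g (suc zero)
    B = bracketList (suc u) (tail g)
    H = bracketList u (tail (tail g))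

    |H| : length H ≡ u + u
    |H| = length-bracketList u (tail (tail g))

    |B| : length B ≡ 2 + (u + u)
    |B| = ≡.trans (length-bracketList (suc u) (tail g)) (≡.cong suc (+-suc u u))

    fits : ∀ {n k} → n ≡ k + (u + u) → k ≤ 4 → n ≤ suc (suc u) + suc (suc u)
    fits n≡k+2u k≤4 = ≤-trans (≤-reflexive n≡k+2u)
      (≤-trans (+-monoˡ-≤ (u + u) k≤4)
               (≤-reflexive (≡.cong (2 +_) (≡.sym (≡.trans (+-suc u (suc u)) (≡.cong suc (+-suc u u)))))))

    W₁ W₂ W₃ : BraidWord (suc (suc u) + suc (suc u))
    W₁ = weaken (fits (≡.cong suc |B|) (n≤1+n 3)) (passRight (length B))
    W₂ = weaken (fits (≡.trans (+-comm (suc (length H)) 3) (≡.cong (4 +_) |H|)) ≤-refl)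
                (shiftBy (length (b ∷ H)) (passRight 2))
    W₃ = weaken (fits (≡.cong (2 +_) |H|) (m≤n+m 2 2)) (shift (passLeft (length H)))

    aa⁻¹≈ε : product (a ∷ a ⁻¹ ∷ []) ≈ ε
    aa⁻¹≈ε = trans (∙-congˡ (identityʳ (a ⁻¹))) (inverseʳ a)

    S₀ S₁ S₂ : Seq → Seq
    S₀ r = bracketList (suc (suc u)) g ++ˢ r
    S₁ r = b ∷ˢ (H ++ˢ (b ⁻¹ ∷ˢ a ∷ˢ a ⁻¹ ∷ˢ r))
    S₂ r = b ∷ˢ (H ++ˢ (a ∷ˢ a ⁻¹ ∷ˢ b ⁻¹ ∷ˢ r))

    step₁ : ∀ r → actWordˢ (S₀ r) W₁ ≐ S₁ r
    step₁ r = begin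
      actWordˢ (bracketList (suc (suc u)) g ++ˢ r) W₁
        ≡⟨ actWordˢ-weaken _ (S₀ r) (passRight (length B)) ⟩
      actWordˢ (bracketList (suc (suc u)) g ++ˢ r) (passRight (length B))
        ≈⟨ actWordˢ-cong (passRight (length B)) (bracketList-++ˢ (suc u) g r) ⟩
      actWordˢ (a ∷ˢ (B ++ˢ (a ⁻¹ ∷ˢ r))) (passRight (length B))
        ≈⟨ passRight-trivial B a (a ⁻¹ ∷ˢ r) (product-bracketList (suc u) (tail g)) ⟩
      B ++ˢ (a ∷ˢ a ⁻¹ ∷ˢ r)
        ≈⟨ bracketList-++ˢ u (tail g) _ ⟩
      b ∷ˢ (H ++ˢ (b ⁻¹ ∷ˢ a ∷ˢ a ⁻¹ ∷ˢ r)) ∎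

    step₂ : ∀ r → actWordˢ (S₁ r) W₂ ≐ S₂ r
    step₂ r = begin
      actWordˢ ((b ∷ H) ++ˢ (b ⁻¹ ∷ˢ a ∷ˢ a ⁻¹ ∷ˢ r)) W₂
        ≡⟨ actWordˢ-weaken _ (S₁ r) (shiftBy (length (b ∷ H)) (passRight 2)) ⟩
      actWordˢ ((b ∷ H) ++ˢ (b ⁻¹ ∷ˢ a ∷ˢ a ⁻¹ ∷ˢ r)) (shiftBy (length (b ∷ H)) (passRight 2))
        ≡⟨ actWordˢ-shiftBy (b ∷ H) _ (passRight 2) ⟩
      (b ∷ H) ++ˢ actWordˢ (b ⁻¹ ∷ˢ ((a ∷ a ⁻¹ ∷ []) ++ˢ r)) (passRight 2)
        ≈⟨ ++ˢ-congʳ (b ∷ H) (passRight-trivial (a ∷ a ⁻¹ ∷ []) (b ⁻¹) r aa⁻¹≈ε) ⟩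
      (b ∷ H) ++ˢ (a ∷ˢ a ⁻¹ ∷ˢ b ⁻¹ ∷ˢ r) ∎

    step₃ : ∀ r → actWordˢ (S₂ r) W₃ ≐ bracketList (suc (suc u)) (g ∘ swap₀₁) ++ˢ r
    step₃ r = begin
      actWordˢ (b ∷ˢ (H ++ˢ (a ∷ˢ a ⁻¹ ∷ˢ b ⁻¹ ∷ˢ r))) W₃
        ≡⟨ actWordˢ-weaken _ (S₂ r) (shift (passLeft (length H))) ⟩
      actWordˢ (b ∷ˢ (H ++ˢ (a ∷ˢ a ⁻¹ ∷ˢ b ⁻¹ ∷ˢ r))) (shift (passLeft (length H)))
        ≡⟨ actWordˢ-shift b _ (passLeft (length H)) ⟩
      b ∷ˢ actWordˢ (H ++ˢ (a ∷ˢ a ⁻¹ ∷ˢ b ⁻¹ ∷ˢ r)) (passLeft (length H))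
        ≈⟨ ∷ˢ-cong refl (passLeft-trivial H a _ (product-bracketList u (tail (tail g)))) ⟩
      b ∷ˢ a ∷ˢ (H ++ˢ (a ⁻¹ ∷ˢ b ⁻¹ ∷ˢ r))
        ≈⟨ ∷ˢ-cong refl (bracketList-++ˢ u (tail (g ∘ swap₀₁)) (b ⁻¹ ∷ˢ r)) ⟨
      b ∷ˢ (bracketList (suc u) (tail (g ∘ swap₀₁)) ++ˢ (b ⁻¹ ∷ˢ r))
        ≈⟨ bracketList-++ˢ (suc u) (g ∘ swap₀₁) r ⟨
      bracketList (suc (suc u)) (g ∘ swap₀₁) ++ˢ r ∎

  bringToFront : ∀ {n} → Fin (suc n) → Fin (suc n) → Fin (suc n)
  bringToFront j zero    = j
  bringToFront j (suc i) = punchIn j i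

  realisable-bringToFront : ∀ {n} (j : Fin (suc n)) → Realisable (suc n) (bringToFront j)
  realisable-bringToFront zero =
    realisable-ext (λ { zero → ≡.refl ; (suc i) → ≡.refl }) realisable-id
  realisable-bringToFront {suc n} (suc j) =
    realisable-ext (λ { zero → ≡.refl ; (suc zero) → ≡.refl ; (suc (suc i)) → ≡.refl })
      (realisable-∘ (realisable-lift (realisable-bringToFront j)) realisable-swap₀₁)

  realisable-permutation : ∀ {u} (π : Permutation′ u) → Realisable u (π ⟨$⟩ʳ_)
  realisable-permutation {zero}  π = realisable-ext (λ ()) realisable-id
  realisable-permutation {suc u} π =
    realisable-ext π-decomposition
      (realisable-∘ (realisable-bringToFront (π ⟨$⟩ʳ zero))
                    (realisable-lift (realisable-permutation (remove zero π))))
    where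
    π-decomposition : ∀ i → bringToFront (π ⟨$⟩ʳ zero) (lift 1 (remove zero π ⟨$⟩ʳ_) i) ≡ π ⟨$⟩ʳ i
    π-decomposition zero    = ≡.refl
    π-decomposition (suc i) = ≡.sym (punchIn-permute π zero i)

  Agrees : ∀ {m} → Vector Carrier m → Seq → Set ℓ
  Agrees x f = ∀ k → x k ≈ f (toℕ k)

  agrees-fromℕ< : ∀ {m x f} → Agrees {m} x f → ∀ {n} (n<m : n < m) → x (fromℕ< n<m) ≈ f n
  agrees-fromℕ< {f = f} x~f n<m = trans (x~f _) (reflexive (≡.cong f (toℕ-fromℕ< n<m)))

  agrees-move : ∀ {m x f} → Agrees {m} x f → ∀ {i} (1+i<m : suc i < m) s →
    let a = x (fromℕ< (<-trans (n<1+n i) 1+i<m)); b = x (fromℕ< 1+i<m) in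
    proj₁ (move s a b) ≈ moveAt i s f i × proj₂ (move s a b) ≈ moveAt i s f (suc i)
  agrees-move {f = f} x~f {i} 1+i<m s =
    let a≈ , b≈ = move-cong s (agrees-fromℕ< {f = f} x~f (<-trans (n<1+n i) 1+i<m)) (agrees-fromℕ< {f = f} x~f 1+i<m)
    in trans a≈ (reflexive (≡.sym (moveAt-fst i s f))) , trans b≈ (reflexive (≡.sym (moveAt-snd i s f)))

  agrees-actLetter : ∀ {m x f} → Agrees {m} x f → ∀ l → Agrees (actLetter G x l) (actLetterˢ f l)
  agrees-actLetter {f = f} x~f ((i , 1+i<m) , s) k with toℕ k ≟ i | toℕ k ≟ suc i
  ... | no k≢i | no k≢1+i = trans (x~f k) (reflexive (≡.sym (moveAt-other i s f k≢i k≢1+i)))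
  ... | yes k≡i | _ with s
  ...   | true  = trans (proj₁ (agrees-move x~f 1+i<m true))  (reflexive (≡.cong (moveAt i true f) (≡.sym k≡i)))
  ...   | false = trans (proj₁ (agrees-move x~f 1+i<m false)) (reflexive (≡.cong (moveAt i false f) (≡.sym k≡i)))
  agrees-actLetter {f = f} x~f ((i , 1+i<m) , s) k | no _ | yes k≡1+i with s
  ...   | true  = trans (proj₂ (agrees-move x~f 1+i<m true))  (reflexive (≡.cong (moveAt i true f) (≡.sym k≡1+i)))
  ...   | false = trans (proj₂ (agrees-move x~f 1+i<m false)) (reflexive (≡.cong (moveAt i false f) (≡.sym k≡1+i)))

  agrees-actWord : ∀ {m x f} → Agrees {m} x f → ∀ W → Agrees (actWord G x W) (actWordˢ f W)
  agrees-actWord x~f []      = x~f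
  agrees-actWord x~f (l ∷ W) = agrees-actWord (agrees-actLetter x~f l) W

  bracketList-left : ∀ u g r (j : Fin u) → (bracketList u g ++ˢ r) (toℕ j) ≈ g j
  bracketList-left (suc u) g r zero    = refl
  bracketList-left (suc u) g r (suc j) =
    trans (bracketList-++ˢ u g r (suc (toℕ j))) (bracketList-left u (tail g) _ j)

  bracketList-right : ∀ u g r t (j : Fin u) → toℕ j + suc t ≡ u → (bracketList u g ++ˢ r) (u + t) ≈ g j ⁻¹
  bracketList-right (suc u) g r t zero    1+t≡1+u =
    trans (bracketList-++ˢ u g r (suc (u + t)))
          (reflexive (≡.trans (≡.cong (bracketList u (tail g) ++ˢ (head g ⁻¹ ∷ˢ r)) u+t≡end)
                              (++ˢ-length (bracketList u (tail g)) _ 0)))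
    where
    u+t≡end : u + t ≡ length (bracketList u (tail g)) + 0
    u+t≡end = ≡.trans (≡.cong (u +_) (suc-injective 1+t≡1+u))
                      (≡.sym (≡.trans (+-identityʳ _) (length-bracketList u (tail g))))
  bracketList-right (suc u) g r t (suc j) j+1+t≡u =
    trans (bracketList-++ˢ u g r (suc (u + t))) (bracketList-right u (tail g) _ t j (suc-injective j+1+t≡u))

  agrees-bracket : ∀ u g r → Agrees (bracket G u g) (bracketList u g ++ˢ r)
  agrees-bracket u g r k with splitAt u k in split≡
  ... | inj₁ j = trans (sym (bracketList-left u g r j)) (reflexive (≡.cong (bracketList u g ++ˢ r) j≡k))
    where
    j≡k : toℕ j ≡ toℕ k
    j≡k = ≡.trans (≡.sym (toℕ-↑ˡ j u)) (≡.cong toℕ (splitAt⁻¹-↑ˡ split≡))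
  ... | inj₂ j = trans (sym (bracketList-right u g r (toℕ j) (opposite j) opposite-j+1+j≡u))
                       (reflexive (≡.cong (bracketList u g ++ˢ r) u+j≡k))
    where
    u+j≡k : u + toℕ j ≡ toℕ k
    u+j≡k = ≡.trans (≡.sym (toℕ-↑ʳ u j)) (≡.cong toℕ (splitAt⁻¹-↑ʳ split≡))
    opposite-j+1+j≡u : toℕ (opposite j) + suc (toℕ j) ≡ u
    opposite-j+1+j≡u = ≡.trans (≡.cong (_+ suc (toℕ j)) (opposite-prop j)) (m∸n+n≡m (toℕ<n j))

lemma2p7 : ∀ {c ℓ : Level} (G : Group c ℓ) (u : ℕ) (g : Vector (Group.Carrier G) u)
           (π : Permutation′ u) →
           ∃ λ (Q : BraidWord (u + u)) →
             _≋_ G (actWord G (bracket G u g) Q) (bracket G u (permute G π g))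
lemma2p7 G u g π = W , λ k → begin
  actWord G (bracket G u g) W k                   ≈⟨ agrees-actWord (agrees-bracket u g r) W k ⟩
  actWordˢ (bracketList u g ++ˢ r) W (toℕ k)      ≈⟨ W-realises r (toℕ k) ⟩
  (bracketList u (permute G π g) ++ˢ r) (toℕ k)   ≈⟨ agrees-bracket u (permute G π g) r k ⟨
  bracket G u (permute G π g) k                   ∎
  where
  open Hurwitz G
  open Group G using (ε; setoid)
  open import Relation.Binary.Reasoning.Setoid setoid
  r : Seq
  r _ = ε
  W = proj₁ (realise (realisable-permutation π) g)
  W-realises = proj₂ (realise (realisable-permutation π) g)
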